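{- For each integer $k\geq 3$ and each integer $r$ with $1\leq r\leq k-1$, there exists a graph $G_{k,r}$ such that $\Gamma(G_{k,r})=k$, $\gamma(G_{k,r})=r+1$ and $d_0(G_{k,r})=k+r=\Gamma(G_{k,r})+\gamma(G_{k,r})-1$.
   Context: All graphs are finite and simple. For a graph $G$, $\gamma(G)$ is the domination number (minimum cardinality of a dominating set) and $\Gamma(G)$ is the upper domination number (maximum cardinality of a minimal dominating set). For an integer $k$, the $k$-dominating graph $D_k(G)$ has as vertices the dominating sets of $G$ of cardinality at most $k$, two such sets being adjacent if and only if one can be obtained from the other by adding or deleting a single vertex of $G$. $d_0(G)$ denotes the smallest integer such that $D_k(G)$ is connected for all $k\geq d_0(G)$. -}

module Defs where

open import Data.Nat using (ℕ; _≤_)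
open import Data.Fin using (Fin)
open import Data.Fin.Subset using (Subset; _∈_; _∉_; _∪_; ⁅_⁆; ∣_∣)
open import Data.Product using (Σ; _×_; ∃; ∃-syntax)
open import Data.Sum using (_⊎_)
open import Relation.Nullary using (¬_)
open import Relation.Binary.PropositionalEquality using (_≡_)
open import Relation.Binary.Construct.Closure.ReflexiveTransitive using (Star)

record Graph (n : ℕ) : Set₁ where
  field
    Adj   : Fin n → Fin n → Set
    sym   : ∀ {u v} → Adj u v → Adj v u
    irrefl : ∀ {v} → ¬ Adj v v
open Graph public

module _ {n : ℕ} (G : Graph n) where

  Dominating : Subset n → Set
  Dominating S = ∀ v → v ∈ S ⊎ ∃[ u ] (u ∈ S × Adj G u v)

  -- minimal dominating set: dominating, and no proper subset is dominating.
  -- (Domination is upward-closed, so it suffices to remove single vertices;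
  -- we state it for all proper subsets, as in the definition.)
  MinimalDominating : Subset n → Set
  MinimalDominating S =
    Dominating S × (∀ T → (∀ v → v ∈ T → v ∈ S) → ¬ (T ≡ S) → ¬ Dominating T)

  IsDominationNumber : ℕ → Set
  IsDominationNumber m =
    (∃[ S ] (Dominating S × ∣ S ∣ ≡ m)) × (∀ S → Dominating S → m ≤ ∣ S ∣)

  IsUpperDominationNumber : ℕ → Set
  IsUpperDominationNumber m =
    (∃[ S ] (MinimalDominating S × ∣ S ∣ ≡ m))
    × (∀ S → MinimalDominating S → ∣ S ∣ ≤ m)

  AddOne : Subset n → Subset n → Set
  AddOne S T = ∃[ v ] (v ∉ S × T ≡ S ∪ ⁅ v ⁆)

  DkEdge : ℕ → Subset n → Subset n → Set
  DkEdge k S T =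
    (Dominating S × ∣ S ∣ ≤ k) × (Dominating T × ∣ T ∣ ≤ k)
    × (AddOne S T ⊎ AddOne T S)

  DkConnected : ℕ → Set
  DkConnected k =
    ∀ S T → Dominating S → ∣ S ∣ ≤ k → Dominating T → ∣ T ∣ ≤ k
      → Star (DkEdge k) S T

  IsD0 : ℕ → Set
  IsD0 m =
    (∀ j → m ≤ j → DkConnected j)
    × (∀ m′ → (∀ j → m′ ≤ j → DkConnected j) → m ≤ m′)

-- G_{k,r} has a vertex u, a k-clique x₁ … x_k joined to u, and r further
-- k-cliques (columns) y_{1j} … y_{kj}, where x_i is joined to its whole row
-- y_{i1} … y_{ir}.  A dominating set either contains every x_i, or misses some
-- x_i; then each y_{ij} must be dominated inside its column, so the set contains
-- a transversal of the columns, and u must be dominated by u or some x.  Hence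
-- the minimal dominating sets are {x₁,…,x_k} (size k) and {w} ∪ transversal with
-- w ∈ N[u] (size r+1), which gives Γ = k and γ = r+1.
-- In D_{k+r-1}, deleting some x_i from a superset of {x₁,…,x_k} would leave a
-- dominating set containing a transversal, so the superset has size ≥ k+r:
-- the sets containing all x_i are cut off from {u} ∪ transversal.  For
-- j ≥ k+r, every dominating set shrinks to a minimal one, and any two minimal
-- ones are joined through unions of size at most k+r.
module Submission where

open import Defs
open import Data.Bool.Properties using () renaming (_≟_ to _≟ᴮ_)
open import Data.Empty using (⊥; ⊥-elim)
open import Data.Fin using (Fin; zero; suc; combine; remQuot)
import Data.Fin.Properties as Fin
open import Data.Fin.Subset
  using (Subset; inside; outside; _∈_; _∉_; _⊆_; _∪_; _∩_; _-_; ⁅_⁆; ∣_∣; Empty)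
  renaming (⊥ to ∅)
open import Data.Fin.Subset.Properties
  using ( _∈?_; ∉⊥; x∈⁅x⁆; x∈⁅y⁆⇒x≡y; x∈p∪q⁻; p⊆p∪q; q⊆p∪q; x∈p∩q⁻; ⊆-antisym
        ; drop-∷-Empty; ∣⊥∣≡0; ∣⁅x⁆∣≡1; ∣p∣≤∣x∷p∣; p⊆q⇒∣p∣≤∣q∣; p─q⊆p; ⊆-refl; ⊆-trans
        ; x∈p∧x≢y⇒x∈p-y; x∈p⇒∣p-x∣<∣p∣ )
open import Data.Nat using (ℕ; zero; suc; _+_; _*_; _∸_; _≤_; _<_; z≤n; s≤s; _≤?_)
open import Data.Nat.Properties
  using (module ≤-Reasoning; ≤-refl; ≤-trans; ≤-reflexive; ≤-pred; +-suc; +-monoʳ-≤; +-monoˡ-≤; ≮⇒≥; <⇒≱; m<m+n)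
open import Data.Product using (Σ; _×_; ∃; ∃-syntax; _,_; proj₁; proj₂)
open import Data.Sum using (_⊎_; inj₁; inj₂; [_,_]′)
open import Data.Unit using (⊤; tt)
open import Data.Vec using (_∷_; []; here; there)
open import Data.Vec.Properties using (≡-dec)
open import Function using (_∘_; case_of_)
open import Function.Definitions using (Injective)
open import Relation.Nullary using (¬_; yes; no)
open import Relation.Nullary.Decidable using (_×-dec_; ¬?; decidable-stable)
open import Relation.Binary.PropositionalEquality as ≡ using (_≡_; _≢_; refl; cong; cong₂; subst; trans)
open import Relation.Binary.Construct.Closure.ReflexiveTransitive
  using (Star; ε; _◅_; _◅◅_; reverse)

private
  variable
    m n : ℕ

module _ where

  private
    variable
      p q t : Subset n
      x : Fin n

  ∪-lub : p ⊆ t → q ⊆ t → p ∪ q ⊆ t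
  ∪-lub {p = p} {q = q} p⊆t q⊆t z∈p∪q = [ p⊆t , q⊆t ]′ (x∈p∪q⁻ p q z∈p∪q)

  x∈p⇒⁅x⁆⊆p : x ∈ p → ⁅ x ⁆ ⊆ p
  x∈p⇒⁅x⁆⊆p {x = x} {p = p} x∈p z∈⁅x⁆ = subst (_∈ p) (≡.sym (x∈⁅y⁆⇒x≡y x z∈⁅x⁆)) x∈p

  x∉p-x : ∀ (x : Fin n) p → x ∉ p - x
  x∉p-x zero    (_ ∷ p) ()
  x∉p-x (suc x) (_ ∷ p) (there x∈p-x) = x∉p-x x p x∈p-x

  p-x∪⁅x⁆≡p : x ∈ p → (p - x) ∪ ⁅ x ⁆ ≡ p
  p-x∪⁅x⁆≡p {x = x} {p = p} x∈p = ⊆-antisym (∪-lub (p─q⊆p p ⁅ x ⁆) (x∈p⇒⁅x⁆⊆p x∈p)) p⊆p-x∪⁅x⁆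
    where
    p⊆p-x∪⁅x⁆ : p ⊆ (p - x) ∪ ⁅ x ⁆
    p⊆p-x∪⁅x⁆ {z} z∈p with z Fin.≟ x
    ... | yes refl = q⊆p∪q (p - x) ⁅ x ⁆ (x∈⁅x⁆ x)
    ... | no z≢x   = p⊆p∪q ⁅ x ⁆ (x∈p∧x≢y⇒x∈p-y z∈p z≢x)

  ∣p∪q∣≤∣p∣+∣q∣ : ∀ (p q : Subset n) → ∣ p ∪ q ∣ ≤ ∣ p ∣ + ∣ q ∣
  ∣p∪q∣≤∣p∣+∣q∣ []            []            = z≤n
  ∣p∪q∣≤∣p∣+∣q∣ (inside  ∷ p) (s ∷ q)       =
    s≤s (≤-trans (∣p∪q∣≤∣p∣+∣q∣ p q) (+-monoʳ-≤ ∣ p ∣ (∣p∣≤∣x∷p∣ s q)))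
  ∣p∪q∣≤∣p∣+∣q∣ (outside ∷ p) (inside  ∷ q) =
    ≤-trans (s≤s (∣p∪q∣≤∣p∣+∣q∣ p q)) (≤-reflexive (≡.sym (+-suc ∣ p ∣ ∣ q ∣)))
  ∣p∪q∣≤∣p∣+∣q∣ (outside ∷ p) (outside ∷ q) = ∣p∪q∣≤∣p∣+∣q∣ p q

  ∣p∪q∣≡∣p∣+∣q∣ : ∀ (p q : Subset n) → Empty (p ∩ q) → ∣ p ∪ q ∣ ≡ ∣ p ∣ + ∣ q ∣
  ∣p∪q∣≡∣p∣+∣q∣ []            []            _      = refl
  ∣p∪q∣≡∣p∣+∣q∣ (inside  ∷ p) (inside  ∷ q) p∩q=∅ = ⊥-elim (p∩q=∅ (zero , here))
  ∣p∪q∣≡∣p∣+∣q∣ (inside  ∷ p) (outside ∷ q) p∩q=∅ =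
    cong suc (∣p∪q∣≡∣p∣+∣q∣ p q (drop-∷-Empty p∩q=∅))
  ∣p∪q∣≡∣p∣+∣q∣ (outside ∷ p) (inside  ∷ q) p∩q=∅ =
    trans (cong suc (∣p∪q∣≡∣p∣+∣q∣ p q (drop-∷-Empty p∩q=∅))) (≡.sym (+-suc ∣ p ∣ ∣ q ∣))
  ∣p∪q∣≡∣p∣+∣q∣ (outside ∷ p) (outside ∷ q) p∩q=∅ =
    ∣p∪q∣≡∣p∣+∣q∣ p q (drop-∷-Empty p∩q=∅)

  ∣⁅x⁆∪p∣≤1+∣p∣ : ∀ (x : Fin n) p → ∣ ⁅ x ⁆ ∪ p ∣ ≤ suc ∣ p ∣
  ∣⁅x⁆∪p∣≤1+∣p∣ x p =
    ≤-trans (∣p∪q∣≤∣p∣+∣q∣ ⁅ x ⁆ p) (≤-reflexive (cong (_+ ∣ p ∣) (∣⁅x⁆∣≡1 x)))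

  x∉p⇒∣⁅x⁆∪p∣≡1+∣p∣ : x ∉ p → ∣ ⁅ x ⁆ ∪ p ∣ ≡ suc ∣ p ∣
  x∉p⇒∣⁅x⁆∪p∣≡1+∣p∣ {x = x} {p = p} x∉p =
    trans (∣p∪q∣≡∣p∣+∣q∣ ⁅ x ⁆ p disjoint) (cong (_+ ∣ p ∣) (∣⁅x⁆∣≡1 x))
    where
    disjoint : Empty (⁅ x ⁆ ∩ p)
    disjoint (z , z∈⁅x⁆∩p) with x∈p∩q⁻ ⁅ x ⁆ p z∈⁅x⁆∩p
    ... | z∈⁅x⁆ , z∈p = x∉p (subst (_∈ p) (x∈⁅y⁆⇒x≡y x z∈⁅x⁆) z∈p)

  image : (Fin m → Fin n) → Subset n
  image {zero}  f = ∅
  image {suc m} f = ⁅ f zero ⁆ ∪ image (f ∘ suc)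

  f∈image : ∀ (f : Fin m → Fin n) a → f a ∈ image f
  f∈image f zero    = p⊆p∪q (image (f ∘ suc)) (x∈⁅x⁆ (f zero))
  f∈image f (suc a) = q⊆p∪q ⁅ f zero ⁆ (image (f ∘ suc)) (f∈image (f ∘ suc) a)

  ∈-image⁻ : ∀ (f : Fin m → Fin n) → x ∈ image f → ∃[ a ] x ≡ f a
  ∈-image⁻ {zero}  f x∈∅ = ⊥-elim (∉⊥ x∈∅)
  ∈-image⁻ {suc m} f x∈im with x∈p∪q⁻ ⁅ f zero ⁆ (image (f ∘ suc)) x∈im
  ... | inj₁ x∈⁅f0⁆ = zero , x∈⁅y⁆⇒x≡y (f zero) x∈⁅f0⁆
  ... | inj₂ x∈rest with ∈-image⁻ (f ∘ suc) x∈rest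
  ...   | a , x≡fa = suc a , x≡fa

  ∉-image : ∀ (f : Fin m → Fin n) → (∀ a → x ≢ f a) → x ∉ image f
  ∉-image f x≢f x∈im with ∈-image⁻ f x∈im
  ... | a , x≡fa = x≢f a x≡fa

  image-⊆ : ∀ (f : Fin m → Fin n) → (∀ a → f a ∈ p) → image f ⊆ p
  image-⊆ {p = p} f f∈p x∈im with ∈-image⁻ f x∈im
  ... | a , x≡fa = subst (_∈ p) (≡.sym x≡fa) (f∈p a)

  ∣image∣≡m : ∀ (f : Fin m → Fin n) → Injective _≡_ _≡_ f → ∣ image f ∣ ≡ m
  ∣image∣≡m {zero}  {n} f _ = ∣⊥∣≡0 n
  ∣image∣≡m {suc m} f f-inj = trans
    (x∉p⇒∣⁅x⁆∪p∣≡1+∣p∣ (∉-image (f ∘ suc) λ a f0≡fa → Fin.0≢1+n (f-inj f0≡fa)))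
    (cong suc (∣image∣≡m (f ∘ suc) (Fin.suc-injective ∘ f-inj)))

module _ {n : ℕ} (G : Graph n) where

  private
    variable
      j : ℕ
      x : Fin n
      S M M′ : Subset n

  dominating-mono : M ⊆ S → Dominating G M → Dominating G S
  dominating-mono M⊆S domM v with domM v
  ... | inj₁ v∈M             = inj₁ (M⊆S v∈M)
  ... | inj₂ (w , w∈M , w~v) = inj₂ (w , M⊆S w∈M , w~v)

  minimal-dominating-⊆⇒≡ : MinimalDominating G S → M ⊆ S → Dominating G M → M ≡ S
  minimal-dominating-⊆⇒≡ {S = S} {M = M} (_ , minimal) M⊆S domM =
    decidable-stable (≡-dec _≟ᴮ_ M S) (λ M≢S → minimal M (λ _ → M⊆S) M≢S domM)

  DkEdge-sym : DkEdge G j S M → DkEdge G j M S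
  DkEdge-sym (S∈Dk , M∈Dk , S→M) = M∈Dk , S∈Dk , [ inj₂ , inj₁ ]′ S→M

  remove-edge : x ∈ S → Dominating G (S - x) → ∣ S ∣ ≤ j → DkEdge G j S (S - x)
  remove-edge {x = x} {S = S} x∈S domS-x ∣S∣≤j =
    (dominating-mono (p─q⊆p S ⁅ x ⁆) domS-x , ∣S∣≤j) ,
    (domS-x , ≤-trans (p⊆q⇒∣p∣≤∣q∣ (p─q⊆p S ⁅ x ⁆)) ∣S∣≤j) ,
    inj₂ (x , x∉p-x x S , ≡.sym (p-x∪⁅x⁆≡p x∈S))

  shrink : M ⊆ S → Dominating G M → ∣ S ∣ ≤ j → Star (DkEdge G j) S M
  shrink {S = S} = shrink-within ∣ S ∣ ≤-refl
    where
    shrink-within : ∀ {j S M} bound → ∣ S ∣ ≤ bound →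
      M ⊆ S → Dominating G M → ∣ S ∣ ≤ j → Star (DkEdge G j) S M
    shrink-within {S = S} {M = M} bound ∣S∣≤bound M⊆S domM ∣S∣≤j
      with Fin.any? (λ v → v ∈? S ×-dec ¬? (v ∈? M))
    ... | no S⊆M =
      subst (Star _ S) (⊆-antisym (λ {v} v∈S →
        decidable-stable (v ∈? M) (λ v∉M → S⊆M (v , v∈S , v∉M))) M⊆S) ε
    shrink-within zero ∣S∣≤0 _ _ _ | yes (v , v∈S , _) =
      ⊥-elim (<⇒≱ (≤-trans (x∈p⇒∣p-x∣<∣p∣ v∈S) ∣S∣≤0) z≤n)
    shrink-within {S = S} {M = M} (suc bound) ∣S∣≤bound M⊆S domM ∣S∣≤j | yes (v , v∈S , v∉M) =
      remove-edge v∈S (dominating-mono M⊆S-v domM) ∣S∣≤j ◅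
      shrink-within bound (≤-pred (≤-trans (x∈p⇒∣p-x∣<∣p∣ v∈S) ∣S∣≤bound)) M⊆S-v domM
        (≤-trans (p⊆q⇒∣p∣≤∣q∣ (p─q⊆p S ⁅ v ⁆)) ∣S∣≤j)
      where
      M⊆S-v : M ⊆ S - v
      M⊆S-v z∈M = x∈p∧x≢y⇒x∈p-y (M⊆S z∈M) (λ { refl → v∉M z∈M })

  detour : M ⊆ S → M′ ⊆ S → Dominating G M → Dominating G M′ → ∣ S ∣ ≤ j →
           Star (DkEdge G j) M M′
  detour M⊆S M′⊆S domM domM′ ∣S∣≤j =
    reverse DkEdge-sym (shrink M⊆S domM ∣S∣≤j) ◅◅ shrink M′⊆S domM′ ∣S∣≤j

  connected-via : ∀ R → (∀ S → Dominating G S → ∣ S ∣ ≤ j → Star (DkEdge G j) S R) →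
                  DkConnected G j
  connected-via R to-R S T domS ∣S∣≤j domT ∣T∣≤j =
    to-R S domS ∣S∣≤j ◅◅ reverse DkEdge-sym (to-R T domT ∣T∣≤j)

  IsD0-intro : ∀ m → (∀ j → suc m ≤ j → DkConnected G j) → ¬ DkConnected G m →
               IsD0 G (suc m)
  IsD0-intro m connected disconnected = connected , least
    where
    least : ∀ m′ → (∀ j → m′ ≤ j → DkConnected G j) → suc m ≤ m′
    least m′ connected′ with suc m ≤? m′
    ... | yes m<m′ = m<m′
    ... | no  m≮m′ = ⊥-elim (disconnected (connected′ m (≮⇒≥ m≮m′)))

module Construction (k′ r′ : ℕ) where

  k r N : ℕ
  k = suc k′
  r = suc r′
  N = suc (k * suc r)

  data Vertex : Set where
    u : Vertex
    x : Fin k → Vertex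
    y : Fin k → Fin r → Vertex

  Adjacent : Vertex → Vertex → Set
  Adjacent u       (x _)     = ⊤
  Adjacent (x _)   u         = ⊤
  Adjacent (x i)   (x i′)    = i ≢ i′
  Adjacent (x i)   (y i′ _)  = i ≡ i′
  Adjacent (y i _) (x i′)    = i ≡ i′
  Adjacent (y i j) (y i′ j′) = j ≡ j′ × i ≢ i′
  Adjacent _       _         = ⊥

  Adjacent-sym : ∀ a b → Adjacent a b → Adjacent b a
  Adjacent-sym u       u         ()
  Adjacent-sym u       (x _)     tt              = tt
  Adjacent-sym u       (y _ _)   ()
  Adjacent-sym (x _)   u         tt              = tt
  Adjacent-sym (x i)   (x i′)    i≢i′            = i≢i′ ∘ ≡.sym
  Adjacent-sym (x i)   (y i′ _)  i≡i′            = ≡.sym i≡i′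
  Adjacent-sym (y _ _) u         ()
  Adjacent-sym (y i _) (x i′)    i≡i′            = ≡.sym i≡i′
  Adjacent-sym (y i j) (y i′ j′) (j≡j′ , i≢i′)   = ≡.sym j≡j′ , i≢i′ ∘ ≡.sym

  Adjacent-irrefl : ∀ a → ¬ Adjacent a a
  Adjacent-irrefl u       ()
  Adjacent-irrefl (x i)   i≢i       = i≢i refl
  Adjacent-irrefl (y i j) (_ , i≢i) = i≢i refl

  encode : Vertex → Fin N
  encode u       = zero
  encode (x i)   = suc (combine i zero)
  encode (y i j) = suc (combine i (suc j))

  fromCell : Fin k × Fin (suc r) → Vertex
  fromCell (i , zero)  = x i
  fromCell (i , suc j) = y i j

  decode : Fin N → Vertex
  decode zero    = u
  decode (suc c) = fromCell (remQuot (suc r) c)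

  decode-encode : ∀ a → decode (encode a) ≡ a
  decode-encode u       = refl
  decode-encode (x i)   = cong fromCell (Fin.remQuot-combine i zero)
  decode-encode (y i j) = cong fromCell (Fin.remQuot-combine i (suc j))

  encode-fromCell : ∀ cell → encode (fromCell cell) ≡ suc (combine (proj₁ cell) (proj₂ cell))
  encode-fromCell (i , zero)  = refl
  encode-fromCell (i , suc j) = refl

  encode-decode : ∀ v → encode (decode v) ≡ v
  encode-decode zero    = refl
  encode-decode (suc c) =
    trans (encode-fromCell (remQuot (suc r) c)) (cong suc (Fin.combine-remQuot {k} (suc r) c))

  encode-injective : Injective _≡_ _≡_ encode
  encode-injective {a} {b} ea≡eb =
    trans (≡.sym (decode-encode a)) (trans (cong decode ea≡eb) (decode-encode b))

  G : Graph N
  G = record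
    { Adj    = λ v w → Adjacent (decode v) (decode w)
    ; sym    = λ {v} {w} → Adjacent-sym (decode v) (decode w)
    ; irrefl = λ {v} → Adjacent-irrefl (decode v)
    }

  private
    variable
      i : Fin k
      c : Fin r → Fin k
      w : Vertex
      S A B : Subset N

  _∈ᵛ_ _∉ᵛ_ : Vertex → Subset N → Set
  a ∈ᵛ S = encode a ∈ S
  a ∉ᵛ S = ¬ a ∈ᵛ S

  DominatingV : Subset N → Set
  DominatingV S = ∀ b → b ∈ᵛ S ⊎ ∃[ a ] (a ∈ᵛ S × Adjacent a b)

  dominatingV⇒dominating : DominatingV S → Dominating G S
  dominatingV⇒dominating {S} dom v with dom (decode v)
  ... | inj₁ v∈S              = inj₁ (subst (_∈ S) (encode-decode v) v∈S)
  ... | inj₂ (a , a∈S , a~v) =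
    inj₂ (encode a , a∈S , subst (λ b → Adjacent b (decode v)) (≡.sym (decode-encode a)) a~v)

  dominating⇒dominatingV : Dominating G S → DominatingV S
  dominating⇒dominatingV {S} dom b with dom (encode b)
  ... | inj₁ b∈S              = inj₁ b∈S
  ... | inj₂ (v , v∈S , v~b) =
    inj₂ (decode v , subst (_∈ S) (≡.sym (encode-decode v)) v∈S
         , subst (Adjacent (decode v)) (decode-encode b) v~b)

  data N[u] : Vertex → Set where
    u∈N[u] : N[u] u
    x∈N[u] : ∀ i → N[u] (x i)

  Xs : Subset N
  Xs = image (encode ∘ x)

  transversal : (Fin r → Fin k) → Subset N
  transversal c = image (λ j → encode (y (c j) j))

  transversal⁺ : Vertex → (Fin r → Fin k) → Subset N
  transversal⁺ w c = ⁅ encode w ⁆ ∪ transversal c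

  x∈Xs : ∀ i → x i ∈ᵛ Xs
  x∈Xs = f∈image (encode ∘ x)

  y∈transversal : ∀ c j → y (c j) j ∈ᵛ transversal c
  y∈transversal c = f∈image (λ j → encode (y (c j) j))

  w∈transversal⁺ : ∀ w c → w ∈ᵛ transversal⁺ w c
  w∈transversal⁺ w c = p⊆p∪q (transversal c) (x∈⁅x⁆ (encode w))

  transversal⊆transversal⁺ : ∀ w c → transversal c ⊆ transversal⁺ w c
  transversal⊆transversal⁺ w c = q⊆p∪q ⁅ encode w ⁆ (transversal c)

  y∉Xs : ∀ i j → y i j ∉ᵛ Xs
  y∉Xs i j = ∉-image (encode ∘ x) λ a e → case encode-injective {y i j} {x a} e of λ ()

  N[u]∉transversal : N[u] w → w ∉ᵛ transversal c
  N[u]∉transversal {c = c} u∈N[u] =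
    ∉-image _ λ j e → case encode-injective {u} {y (c j) j} e of λ ()
  N[u]∉transversal {c = c} (x∈N[u] i) =
    ∉-image _ λ j e → case encode-injective {x i} {y (c j) j} e of λ ()

  ∣Xs∣≡k : ∣ Xs ∣ ≡ k
  ∣Xs∣≡k = ∣image∣≡m (encode ∘ x) λ {a} {b} e → x-injective (encode-injective {x a} {x b} e)
    where
    x-injective : Injective _≡_ _≡_ x
    x-injective refl = refl

  ∣transversal∣≡r : ∀ c → ∣ transversal c ∣ ≡ r
  ∣transversal∣≡r c = ∣image∣≡m _ λ {a} {b} e → column (encode-injective {y (c a) a} {y (c b) b} e)
    where
    column : ∀ {i i′ j j′} → y i j ≡ y i′ j′ → j ≡ j′
    column refl = refl

  ∣transversal⁺∣≡1+r : N[u] w → ∀ c → ∣ transversal⁺ w c ∣ ≡ suc r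
  ∣transversal⁺∣≡1+r w∈N[u] c =
    trans (x∉p⇒∣⁅x⁆∪p∣≡1+∣p∣ (N[u]∉transversal {c = c} w∈N[u])) (cong suc (∣transversal∣≡r c))

  ∣Xs∪transversal∣≡k+r : ∀ c → ∣ Xs ∪ transversal c ∣ ≡ k + r
  ∣Xs∪transversal∣≡k+r c =
    trans (∣p∪q∣≡∣p∣+∣q∣ Xs (transversal c) disjoint) (cong₂ _+_ ∣Xs∣≡k (∣transversal∣≡r c))
    where
    disjoint : Empty (Xs ∩ transversal c)
    disjoint (z , z∈Xs∩T) with x∈p∩q⁻ Xs (transversal c) z∈Xs∩T
    ... | z∈Xs , z∈T with ∈-image⁻ (encode ∘ x) z∈Xs
    ... | i , refl = N[u]∉transversal {c = c} (x∈N[u] i) z∈T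

  Xs-dominating : Dominating G Xs
  Xs-dominating = dominatingV⇒dominating λ where
    u       → inj₂ (x zero , x∈Xs zero , tt)
    (x i)   → inj₁ (x∈Xs i)
    (y i j) → inj₂ (x i , x∈Xs i , refl)

  transversal⁺-dominating : N[u] w → ∀ c → Dominating G (transversal⁺ w c)
  transversal⁺-dominating w∈N[u] c = dominatingV⇒dominating (dominated w∈N[u])
    where
    dominated : N[u] w → DominatingV (transversal⁺ w c)
    dominated {w} u∈N[u]      u       = inj₁ (w∈transversal⁺ w c)
    dominated {w} (x∈N[u] i)  u       = inj₂ (w , w∈transversal⁺ w c , tt)
    dominated {w} u∈N[u]      (x i)   = inj₂ (w , w∈transversal⁺ w c , tt)
    dominated {w} (x∈N[u] i′) (x i) with i′ Fin.≟ i
    ... | yes refl = inj₁ (w∈transversal⁺ w c)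
    ... | no  i′≢i = inj₂ (w , w∈transversal⁺ w c , i′≢i)
    dominated {w} _           (y i j) with c j Fin.≟ i
    ... | yes refl = inj₁ (transversal⊆transversal⁺ w c (y∈transversal c j))
    ... | no  cj≢i = inj₂ (y (c j) j , transversal⊆transversal⁺ w c (y∈transversal c j) , refl , cj≢i)

  u-dominator : Dominating G S → ∃[ w ] (N[u] w × w ∈ᵛ S)
  u-dominator dom with dominating⇒dominatingV dom u
  ... | inj₁ u∈S                = u , u∈N[u] , u∈S
  ... | inj₂ (x i , x∈S , _)    = x i , x∈N[u] i , x∈S
  ... | inj₂ (u , _ , ())
  ... | inj₂ (y _ _ , _ , ())

  missing-row⇒transversal : Dominating G S → x i ∉ᵛ S → ∃[ c ] transversal c ⊆ S
  missing-row⇒transversal {S} {i} dom x∉S =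
    (λ j → proj₁ (column-dominator j)) , image-⊆ _ (λ j → proj₂ (column-dominator j))
    where
    column-dominator : ∀ j → ∃[ i′ ] y i′ j ∈ᵛ S
    column-dominator j with dominating⇒dominatingV dom (y i j)
    ... | inj₁ y∈S                      = i , y∈S
    ... | inj₂ (x _ , x∈S , refl)       = ⊥-elim (x∉S x∈S)
    ... | inj₂ (y i′ _ , y∈S , refl , _) = i′ , y∈S
    ... | inj₂ (u , _ , ())

  data Core (S : Subset N) : Set where
    Xs-⊆          : Xs ⊆ S → Core S
    transversal⁺-⊆ : N[u] w → ∀ c → transversal⁺ w c ⊆ S → Core S

  core : Dominating G S → Core S
  core {S} dom with Fin.all? (λ i → encode (x i) ∈? S)
  ... | yes all-x = Xs-⊆ (image-⊆ _ all-x)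
  ... | no ¬all-x with Fin.¬∀⟶∃¬ k _ (λ i → encode (x i) ∈? S) ¬all-x | u-dominator dom
  ... | i , x∉S | w , w∈N[u] , w∈S with missing-row⇒transversal {S = S} {i = i} dom x∉S
  ... | c , transversal⊆S =
    transversal⁺-⊆ w∈N[u] c (∪-lub (x∈p⇒⁅x⁆⊆p w∈S) transversal⊆S)

  Xs-minimal : MinimalDominating G Xs
  Xs-minimal = Xs-dominating , proper-subset-not-dominating
    where
    proper-subset-not-dominating : ∀ T → (∀ v → v ∈ T → v ∈ Xs) → ¬ T ≡ Xs → ¬ Dominating G T
    proper-subset-not-dominating T T⊆Xs T≢Xs domT with core domT
    ... | Xs-⊆ Xs⊆T = T≢Xs (⊆-antisym (T⊆Xs _) Xs⊆T)
    ... | transversal⁺-⊆ {w} _ c ⊆T =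
      y∉Xs (c zero) zero (T⊆Xs _ (⊆T (transversal⊆transversal⁺ w c (y∈transversal c zero))))

  c₀ : Fin r → Fin k
  c₀ _ = zero

  centre : Subset N
  centre = transversal⁺ u c₀

  centre-dominating : Dominating G centre
  centre-dominating = transversal⁺-dominating u∈N[u] c₀

  ∣centre∣≡1+r : ∣ centre ∣ ≡ suc r
  ∣centre∣≡1+r = ∣transversal⁺∣≡1+r u∈N[u] c₀

  module _ (r<k : r < k) where

    upper-domination : IsUpperDominationNumber G k
    upper-domination = (Xs , Xs-minimal , ∣Xs∣≡k) , minimal⇒∣S∣≤k
      where
      minimal⇒∣S∣≤k : ∀ S → MinimalDominating G S → ∣ S ∣ ≤ k
      minimal⇒∣S∣≤k S minS with core (proj₁ minS)
      ... | Xs-⊆ Xs⊆S =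
        subst (λ T → ∣ T ∣ ≤ k) (minimal-dominating-⊆⇒≡ G minS Xs⊆S Xs-dominating)
          (≤-reflexive ∣Xs∣≡k)
      ... | transversal⁺-⊆ w∈N[u] c ⊆S =
        subst (λ T → ∣ T ∣ ≤ k)
          (minimal-dominating-⊆⇒≡ G minS ⊆S (transversal⁺-dominating w∈N[u] c))
          (≤-trans (≤-reflexive (∣transversal⁺∣≡1+r w∈N[u] c)) r<k)

    domination : IsDominationNumber G (suc r)
    domination = (centre , centre-dominating , ∣centre∣≡1+r) , dominating⇒1+r≤∣S∣
      where
      dominating⇒1+r≤∣S∣ : ∀ S → Dominating G S → suc r ≤ ∣ S ∣
      dominating⇒1+r≤∣S∣ S domS with core domS
      ... | Xs-⊆ Xs⊆S =
        ≤-trans r<k (subst (_≤ ∣ S ∣) ∣Xs∣≡k (p⊆q⇒∣p∣≤∣q∣ Xs⊆S))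
      ... | transversal⁺-⊆ w∈N[u] c ⊆S =
        subst (_≤ ∣ S ∣) (∣transversal⁺∣≡1+r w∈N[u] c) (p⊆q⇒∣p∣≤∣q∣ ⊆S)

  Xs∪transversal-too-large : ∀ c → Xs ∪ transversal c ⊆ A → ¬ ∣ A ∣ ≤ k′ + r
  Xs∪transversal-too-large c ⊆A =
    <⇒≱ (subst (_≤ _) (∣Xs∪transversal∣≡k+r c) (p⊆q⇒∣p∣≤∣q∣ ⊆A))

  Xs⊆-preserved : DkEdge G (k′ + r) A B → Xs ⊆ A → Xs ⊆ B
  Xs⊆-preserved (_ , _ , inj₁ (v , _ , B≡A∪v)) Xs⊆A z∈Xs =
    subst (_ ∈_) (≡.sym B≡A∪v) (p⊆p∪q ⁅ v ⁆ (Xs⊆A z∈Xs))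
  Xs⊆-preserved {A = A} {B = B} ((_ , ∣A∣≤) , (domB , _) , inj₂ (v , v∉B , A≡B∪v)) Xs⊆A {z} z∈Xs
    with x∈p∪q⁻ B ⁅ v ⁆ (subst (z ∈_) A≡B∪v (Xs⊆A z∈Xs))
  ... | inj₁ z∈B   = z∈B
  ... | inj₂ z∈⁅v⁆ with ∈-image⁻ (encode ∘ x) z∈Xs
  ... | i , refl with missing-row⇒transversal {i = i} domB
                        (v∉B ∘ subst (_∈ B) (x∈⁅y⁆⇒x≡y v z∈⁅v⁆))
  ... | c , transversal⊆B =
    ⊥-elim (Xs∪transversal-too-large c (∪-lub Xs⊆A (B⊆A ∘ transversal⊆B)) ∣A∣≤)
    where
    B⊆A : B ⊆ A
    B⊆A z∈B = subst (_ ∈_) (≡.sym A≡B∪v) (p⊆p∪q ⁅ v ⁆ z∈B)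

  Xs⊆-invariant : Star (DkEdge G (k′ + r)) A B → Xs ⊆ A → Xs ⊆ B
  Xs⊆-invariant ε        Xs⊆A = Xs⊆A
  Xs⊆-invariant (e ◅ es) Xs⊆A = Xs⊆-invariant es (Xs⊆-preserved e Xs⊆A)

  x∉centre : x i ∉ᵛ centre
  x∉centre {i} x∈centre with x∈p∪q⁻ ⁅ encode u ⁆ (transversal c₀) x∈centre
  ... | inj₁ x∈⁅u⁆ = case encode-injective {x i} {u} (x∈⁅y⁆⇒x≡y (encode u) x∈⁅u⁆) of λ ()
  ... | inj₂ x∈T   = N[u]∉transversal {c = c₀} (x∈N[u] i) x∈T

  disconnected : 1 < k → ¬ DkConnected G (k′ + r)
  disconnected 1<k connected =
    x∉centre {zero} (Xs⊆-invariant (connected Xs centre Xs-dominating ∣Xs∣≤ centre-dominating ∣centre∣≤)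
                      ⊆-refl (x∈Xs zero))
    where
    ∣Xs∣≤ : ∣ Xs ∣ ≤ k′ + r
    ∣Xs∣≤ = subst (_≤ k′ + r) (≡.sym ∣Xs∣≡k) (m<m+n k′ (s≤s z≤n))
    ∣centre∣≤ : ∣ centre ∣ ≤ k′ + r
    ∣centre∣≤ = subst (_≤ k′ + r) (≡.sym ∣centre∣≡1+r) (+-monoˡ-≤ r (≤-pred 1<k))

  module _ (r<k : r < k) (1<k : 1 < k) {j : ℕ} (k+r≤j : k + r ≤ j) where

    ∣⁅u⁆∪transversal⁺∣≤j : N[u] w → ∀ c → ∣ ⁅ encode u ⁆ ∪ transversal⁺ w c ∣ ≤ j
    ∣⁅u⁆∪transversal⁺∣≤j {w} w∈N[u] c = begin
      ∣ ⁅ encode u ⁆ ∪ transversal⁺ w c ∣ ≤⟨ ∣⁅x⁆∪p∣≤1+∣p∣ (encode u) (transversal⁺ w c) ⟩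
      suc ∣ transversal⁺ w c ∣           ≡⟨ cong suc (∣transversal⁺∣≡1+r w∈N[u] c) ⟩
      2 + r                              ≤⟨ +-monoˡ-≤ r 1<k ⟩
      k + r                              ≤⟨ k+r≤j ⟩
      j                                  ∎
      where open ≤-Reasoning

    ∣transversal⁺∪transversal∣≤j : ∀ c c′ → ∣ transversal⁺ u c ∪ transversal c′ ∣ ≤ j
    ∣transversal⁺∪transversal∣≤j c c′ = begin
      ∣ transversal⁺ u c ∪ transversal c′ ∣     ≤⟨ ∣p∪q∣≤∣p∣+∣q∣ (transversal⁺ u c) (transversal c′) ⟩
      ∣ transversal⁺ u c ∣ + ∣ transversal c′ ∣ ≡⟨ cong₂ _+_ (∣transversal⁺∣≡1+r u∈N[u] c) (∣transversal∣≡r c′) ⟩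
      suc r + r                                ≤⟨ +-monoˡ-≤ r r<k ⟩
      k + r                                    ≤⟨ k+r≤j ⟩
      j                                        ∎
      where open ≤-Reasoning

    -- First trade w for u inside a set of size r + 2, then trade the transversal
    -- for c₀ inside one of size 2r + 1; both stay within k + r.
    transversal⁺⇝centre : N[u] w → ∀ c → Star (DkEdge G j) (transversal⁺ w c) centre
    transversal⁺⇝centre {w} w∈N[u] c =
      detour G (q⊆p∪q ⁅ encode u ⁆ _)
               (∪-lub (p⊆p∪q _) (⊆-trans (transversal⊆transversal⁺ w c) (q⊆p∪q ⁅ encode u ⁆ _)))
               (transversal⁺-dominating w∈N[u] c) (transversal⁺-dominating u∈N[u] c)
               (∣⁅u⁆∪transversal⁺∣≤j w∈N[u] c)
      ◅◅
      detour G (p⊆p∪q (transversal c₀))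
               (∪-lub (⊆-trans (p⊆p∪q (transversal c)) (p⊆p∪q (transversal c₀))) (q⊆p∪q _ _))
               (transversal⁺-dominating u∈N[u] c) centre-dominating
               (∣transversal⁺∪transversal∣≤j c c₀)

    Xs⇝centre : Star (DkEdge G j) Xs centre
    Xs⇝centre =
      detour G (p⊆p∪q (transversal c₀))
               (∪-lub (⊆-trans (x∈p⇒⁅x⁆⊆p (x∈Xs zero)) (p⊆p∪q _)) (q⊆p∪q _ _))
               Xs-dominating (transversal⁺-dominating (x∈N[u] zero) c₀)
               (≤-trans (≤-reflexive (∣Xs∪transversal∣≡k+r c₀)) k+r≤j)
      ◅◅ transversal⁺⇝centre (x∈N[u] zero) c₀

    dominating⇝centre : ∀ S → Dominating G S → ∣ S ∣ ≤ j → Star (DkEdge G j) S centre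
    dominating⇝centre S domS ∣S∣≤j with core domS
    ... | Xs-⊆ Xs⊆S = shrink G Xs⊆S Xs-dominating ∣S∣≤j ◅◅ Xs⇝centre
    ... | transversal⁺-⊆ w∈N[u] c ⊆S =
      shrink G ⊆S (transversal⁺-dominating w∈N[u] c) ∣S∣≤j ◅◅ transversal⁺⇝centre w∈N[u] c

    connected : DkConnected G j
    connected = connected-via G centre dominating⇝centre

  d₀≡k+r : r < k → 1 < k → IsD0 G (k + r)
  d₀≡k+r r<k 1<k = IsD0-intro G (k′ + r) (λ j → connected r<k 1<k {j}) (disconnected 1<k)

theorem1 : ∀ (k r : ℕ) → 3 ≤ k → 1 ≤ r → r ≤ k ∸ 1
    → ∃[ n ] Σ (Graph n) λ G →
        IsUpperDominationNumber G k
        × IsDominationNumber G (suc r)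
        × IsD0 G (k + r)
        × IsD0 G (k + suc r ∸ 1)
theorem1 (suc k′) (suc r′) 3≤k@(s≤s _) (s≤s z≤n) r≤k-1 =
  N , G , upper-domination (s≤s r≤k-1) , domination (s≤s r≤k-1) , d₀ ,
  subst (IsD0 G) (≡.sym (+-suc k′ (suc r′))) d₀
  where
  open Construction k′ r′
  d₀ : IsD0 G (k + r)
  d₀ = d₀≡k+r (s≤s r≤k-1) (≤-trans (s≤s (s≤s z≤n)) 3≤k)
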